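{- Let $p\ge 2$ and $k$ be positive integers. If a graph $G$ admits a $p$-treedepth coloring with $k$ colors, then $G$ admits a $(p+1)$-centered coloring with $k\bigl(2p\cdot \binom{k-1}{p-1}+1\bigr)<2pk^p$ colors.
   Context: The treedepth of $G$ is the minimum depth of a rooted forest $F$ on vertex set $V(G)$ such that for every edge $uv\in E(G)$, $u$ is an ancestor of $v$ or $v$ is an ancestor of $u$ in $F$ (depth = maximum number of vertices on a root-to-vertex path). A $p$-treedepth coloring of $G$ is a vertex coloring such that for every $i\le p$ the subgraph induced by any $i$ color classes has treedepth at most $i$. A $q$-centered coloring of $G$ is a vertex coloring such that every connected subgraph $H\subseteq G$ either contains a color appearing exactly once in $H$ or receives at least $q$ colors. -}

module Defs where

open import Level using (0ℓ)
open import Data.Nat using (ℕ; zero; suc; _≤_)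
open import Data.Fin using (Fin; _≟_)
open import Data.Fin.Properties using (any?)
open import Data.Fin.Subset using (Subset; _∈_; ∣_∣)
open import Data.Fin.Subset.Properties using (_∈?_)
open import Data.Vec using (tabulate)
open import Data.Maybe using (Maybe; just; nothing)
open import Data.Product using (Σ; ∃; _×_; _,_; proj₁)
open import Data.Sum using (_⊎_)
open import Relation.Nullary using (¬_)
open import Relation.Nullary.Decidable using (⌊_⌋; _×-dec_)
open import Relation.Binary.PropositionalEquality using (_≡_)

record Graph : Set₁ where
  field
    n     : ℕ
    Adj   : Fin n → Fin n → Set
    sym   : ∀ {u v} → Adj u v → Adj v u
    irref : ∀ {v} → ¬ Adj v v
open Graph public

-- Rooted forests, given by a parent map (nothing = root).

climb : {W : Set} → (W → Maybe W) → ℕ → W → Maybe W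
climb par zero    v = just v
climb par (suc j) v with par v
... | nothing = nothing
... | just u  = climb par j u

Ancestor : {W : Set} → (W → Maybe W) → W → W → Set
Ancestor par u v = ∃ λ j → climb par j v ≡ just u

-- Every root-to-vertex path has at most d vertices
-- (equivalently: the d-th ancestor of every vertex does not exist).
-- This also forces the parent map to be acyclic, i.e. to be a rooted forest.
DepthAtMost : {W : Set} → (W → Maybe W) → ℕ → Set
DepthAtMost par d = ∀ v → climb par d v ≡ nothing

TreedepthAtMost : (W : Set) → (W → W → Set) → ℕ → Set
TreedepthAtMost W E d =
  Σ (W → Maybe W) λ par →
    DepthAtMost par d ×
    (∀ u v → E u v → Ancestor par u v ⊎ Ancestor par v u)

Coloring : Graph → ℕ → Set
Coloring G k = Fin (n G) → Fin k

InClasses : (G : Graph) {k : ℕ} → Coloring G k → Subset k → Set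
InClasses G c S = Σ (Fin (n G)) λ v → c v ∈ S

IsTreedepthColoring : (p : ℕ) (G : Graph) {k : ℕ} → Coloring G k → Set
IsTreedepthColoring p G {k} c =
  ∀ (i : ℕ) → i ≤ p → (S : Subset k) → ∣ S ∣ ≡ i →
    TreedepthAtMost (InClasses G c S)
                    (λ a b → Adj G (proj₁ a) (proj₁ b)) i

data ReachIn (G : Graph) (X : Subset (n G)) : Fin (n G) → Fin (n G) → Set where
  here : ∀ {v} → v ∈ X → ReachIn G X v v
  step : ∀ {u w v} → u ∈ X → Adj G u w → ReachIn G X w v → ReachIn G X u v

Connected : (G : Graph) → Subset (n G) → Set
Connected G X = (∃ λ v → v ∈ X) × (∀ u v → u ∈ X → v ∈ X → ReachIn G X u v)

colorsOn : (G : Graph) {k : ℕ} → Coloring G k → Subset (n G) → Subset k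
colorsOn G c X = tabulate λ j → ⌊ any? (λ v → (v ∈? X) ×-dec (c v ≟ j)) ⌋

HasUniqueColor : (G : Graph) {k : ℕ} → Coloring G k → Subset (n G) → Set
HasUniqueColor G c X =
  ∃ λ v → v ∈ X × (∀ w → w ∈ X → c w ≡ c v → w ≡ v)

-- q-centered coloring: every connected subgraph H either contains a color
-- appearing exactly once in H or receives at least q colors.
-- (Only the vertex set of H matters; connected subgraphs H have connected
-- vertex sets X and conversely G[X] is a connected subgraph.)
IsCenteredColoring : (q : ℕ) (G : Graph) {k : ℕ} → Coloring G k → Set
IsCenteredColoring q G c =
  ∀ (X : Subset (n G)) → Connected G X →
    HasUniqueColor G c X ⊎ q ≤ ∣ colorsOn G c X ∣

-- Suppose first p ≤ k. For each set S of p colours, the treedepth colouring gives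
-- a forest F_S of depth ≤ p whose ancestor relation contains every edge of G[S]. Each vertex w
-- has at most p proper ancestors in each F_S, and w lies in only C(k-1,p-1) of the graphs G[S];
-- so the digraph "w → proper ancestor of w in some F_S" has out-degree ≤ D = p·C(k-1,p-1).
-- Its underlying graph is 2D-degenerate, hence properly colourable with 2D+1 colours by a
-- colouring rank, and the new colouring is v ↦ (c v, rank v). Let X be connected with at most p
-- new colours. Then X meets at most p old colours, which extend to a p-set S; X is connected
-- in G[S], so its topmost vertex r in F_S is an ancestor of all of X, and rank separates r from
-- every other vertex of X. If k < p, one forest F of depth ≤ k covers all of G and the
-- height in F, which separates every vertex from its proper ancestors, does the same job.

module Submission where

open import Defs hiding (sym)
open import Function using (_∘_; id)
open import Data.Bool using (true; false; if_then_else_)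
open import Data.Nat using (ℕ; zero; suc; _+_; _*_; _^_; _∸_; _≤_; _<_; z≤n; s≤s; _≤?_; _<?_)
import Data.Nat as ℕ
open import Data.Nat.Properties hiding (_≟_)
open import Data.Nat.Combinatorics using (_C_; k>n⇒nCk≡0; nCk+nC[k+1]≡[n+1]C[k+1])
open import Data.Nat.Tactic.RingSolver using (solve-∀)
open import Data.Fin using (Fin; zero; suc; fromℕ<; toℕ; combine; remQuot)
open import Data.Fin.Properties
  using (_≟_; any?; pigeonhole; ¬∀⟶∃¬; ¬Fin0; toℕ-fromℕ<;
         combine-injectiveˡ; combine-injectiveʳ; remQuot-combine)
import Data.Fin.Properties as Fin
open import Data.Fin.Subset using (Subset; _∈_; _∉_; _⊆_; _-_; ∣_∣; ⊤; inside; outside)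
open import Data.Fin.Subset.Properties
  using (_∈?_; nonempty?; ∈⊤; ∣⊤∣≡n; ∣⊥∣≡0; s⊆s; ⊆⊤; Empty-unique; p─q⊆p; p─⊥≡p;
         x∈p∧x≢y⇒x∈p-y; x∈p⇒∣p-x∣<∣p∣)
open import Data.Vec using ([]; _∷_; insertAt; removeAt; here; there)
open import Data.Vec.Properties using (insertAt-removeAt; []=⇒lookup; lookup⇒[]=; lookup∘tabulate)
open import Data.Vec.Properties.WithK using ([]=-irrelevant)
open import Data.Maybe using (Maybe; just; nothing)
open import Data.Maybe.Properties using (just-injective)
open import Data.List using (List; []; _∷_; length; map; _++_; concatMap; filter; allFin)
import Data.List as List
open import Data.List.Properties using (length-map; length-++)
open import Data.List.Membership.Propositional using () renaming (_∈_ to _∈ₗ_; _∉_ to _∉ₗ_)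
open import Data.List.Membership.Propositional.Properties
  using (∈-map⁺; ∈-++⁺ˡ; ∈-++⁺ʳ; ∈-concat⁺′; ∈-filter⁺; ∈-allFin)
import Data.List.Membership.DecPropositional as DecMembership
open import Data.List.Membership.Setoid.Properties using (index-injective)
open import Data.List.Relation.Unary.Any using (index; here; there)
open import Data.Product using (Σ; ∃; _×_; _,_; proj₁; proj₂)
open import Data.Sum using (_⊎_; inj₁; inj₂)
open import Algebra.Properties.Semiring.Sum +-*-semiring
  using (sum; sum-syntax; sum-cong-≗; sum-replicate-zero;
         ∑-comm; ∑-distrib-+; *-distribˡ-sum; *-distribʳ-sum)
open import Relation.Nullary using (¬_; Dec; yes; no; does; contradiction)
open import Relation.Nullary.Decidable using (⌊_⌋; _×-dec_)
open import Relation.Unary using (Decidable)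
open import Relation.Binary.Construct.Closure.ReflexiveTransitive using (Star; ε; _◅_)
open import Relation.Binary.PropositionalEquality

𝟙 : {P : Set} → Dec P → ℕ
𝟙 d = if does d then 1 else 0

𝟙-×-dec : ∀ {P Q : Set} (p : Dec P) (q : Dec Q) → 𝟙 (p ×-dec q) ≡ 𝟙 p * 𝟙 q
𝟙-×-dec p q with does p | does q
... | true  | true  = refl
... | true  | false = refl
... | false | _     = refl

𝟙-yes : ∀ {P : Set} (d : Dec P) → P → 𝟙 d ≡ 1
𝟙-yes (yes _) _ = refl
𝟙-yes (no ¬p) p = contradiction p ¬p

sum-mono-≤ : ∀ {n} {f g : Fin n → ℕ} → (∀ i → f i ≤ g i) → sum f ≤ sum g
sum-mono-≤ {zero}  f≤g = z≤n
sum-mono-≤ {suc n} f≤g = +-mono-≤ (f≤g zero) (sum-mono-≤ (f≤g ∘ suc))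

term≤sum : ∀ {n} (f : Fin n → ℕ) i → f i ≤ sum f
term≤sum f zero    = m≤m+n (f zero) _
term≤sum f (suc i) = ≤-trans (term≤sum (f ∘ suc) i) (m≤n+m _ (f zero))

length-filter-tabulate : ∀ {A : Set} {P : A → Set} (P? : Decidable P) {n} (f : Fin n → A) →
  length (filter P? (List.tabulate f)) ≡ ∑[ i < n ] 𝟙 (P? (f i))
length-filter-tabulate P? {zero}  f = refl
length-filter-tabulate P? {suc n} f with does (P? (f zero))
... | true  = cong suc (length-filter-tabulate P? (f ∘ suc))
... | false = length-filter-tabulate P? (f ∘ suc)

∑-𝟙≟ : ∀ {n} (y : Fin n) → ∑[ x < n ] 𝟙 (x ≟ y) ≡ 1
∑-𝟙≟ {suc n} zero = cong suc (sum-replicate-zero n)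
∑-𝟙≟ (suc y) = ∑-𝟙≟ y

missing-element : ∀ {N} (xs : List (Fin N)) → length xs < N → ∃ λ x → x ∉ₗ xs
missing-element {N} xs |xs|<N = ¬∀⟶∃¬ N (_∈ₗ xs) (_∈ₗ? xs) all∈-impossible
  where
  open DecMembership (_≟_ {N}) using () renaming (_∈?_ to _∈ₗ?_)
  all∈-impossible : ¬ (∀ x → x ∈ₗ xs)
  all∈-impossible all∈ with pigeonhole |xs|<N (index ∘ all∈)
  ... | i , j , i<j , same = Fin.<⇒≢ i<j (index-injective (setoid _) (all∈ i) (all∈ j) same)

-- Greedy colouring of digraphs with bounded out-degree

module _ {n : ℕ} where
  open DecMembership (_≟_ {n}) using () renaming (_∈?_ to _∈ₗ?_)

  ∑-𝟙-∈ₗ?≤length : (xs : List (Fin n)) → ∑[ x < n ] 𝟙 (x ∈ₗ? xs) ≤ length xs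
  ∑-𝟙-∈ₗ?≤length [] = ≤-reflexive (sum-replicate-zero n)
  ∑-𝟙-∈ₗ?≤length (y ∷ ys) = begin
    ∑[ x < n ] 𝟙 (x ∈ₗ? y ∷ ys)                    ≤⟨ sum-mono-≤ 𝟙-∈ₗ?-∷ ⟩
    ∑[ x < n ] (𝟙 (x ≟ y) + 𝟙 (x ∈ₗ? ys))          ≡⟨ ∑-distrib-+ (λ x → 𝟙 (x ≟ y)) _ ⟩
    ∑[ x < n ] 𝟙 (x ≟ y) + ∑[ x < n ] 𝟙 (x ∈ₗ? ys) ≡⟨ cong (_+ _) (∑-𝟙≟ y) ⟩
    suc (∑[ x < n ] 𝟙 (x ∈ₗ? ys))                  ≤⟨ s≤s (∑-𝟙-∈ₗ?≤length ys) ⟩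
    suc (length ys)                                ∎
    where
    open ≤-Reasoning
    𝟙-∈ₗ?-∷ : ∀ x → 𝟙 (x ∈ₗ? y ∷ ys) ≤ 𝟙 (x ≟ y) + 𝟙 (x ∈ₗ? ys)
    𝟙-∈ₗ?-∷ x with does (x ≟ y)
    ... | true  = s≤s z≤n
    ... | false = ≤-refl

  module GreedyColouring {D : ℕ} (out : Fin n → List (Fin n))
    (|out|≤D : ∀ a → length (out a) ≤ D) where

    inNeighbours : Subset n → Fin n → List (Fin n)
    inNeighbours U u = filter (λ v → (v ∈? U) ×-dec (u ∈ₗ? out v)) (allFin n)

    indegree : Subset n → Fin n → ℕ
    indegree U u = length (inNeighbours U u)

    indegree≡∑ : ∀ U u → indegree U u ≡ ∑[ v < n ] (𝟙 (v ∈? U) * 𝟙 (u ∈ₗ? out v))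
    indegree≡∑ U u = trans (length-filter-tabulate _ (id {A = Fin n}))
      (sum-cong-≗ λ v → 𝟙-×-dec (v ∈? U) (u ∈ₗ? out v))

    ∑-indegree≤ : ∀ U → ∑[ u < n ] indegree U u ≤ (∑[ v < n ] 𝟙 (v ∈? U)) * D
    ∑-indegree≤ U = begin
      ∑[ u < n ] indegree U u                               ≡⟨ sum-cong-≗ (indegree≡∑ U) ⟩
      ∑[ u < n ] ∑[ v < n ] (𝟙 (v ∈? U) * 𝟙 (u ∈ₗ? out v)) ≡⟨ ∑-comm (λ u v → 𝟙 (v ∈? U) * 𝟙 (u ∈ₗ? out v)) ⟩
      ∑[ v < n ] ∑[ u < n ] (𝟙 (v ∈? U) * 𝟙 (u ∈ₗ? out v)) ≡⟨ sum-cong-≗ pull-out ⟨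
      ∑[ v < n ] (𝟙 (v ∈? U) * ∑[ u < n ] 𝟙 (u ∈ₗ? out v)) ≤⟨ sum-mono-≤ outdegree≤D ⟩
      ∑[ v < n ] (𝟙 (v ∈? U) * D)                           ≡⟨ *-distribʳ-sum D (λ v → 𝟙 (v ∈? U)) ⟨
      (∑[ v < n ] 𝟙 (v ∈? U)) * D                           ∎
      where
      open ≤-Reasoning
      pull-out : ∀ v →
        𝟙 (v ∈? U) * ∑[ u < n ] 𝟙 (u ∈ₗ? out v) ≡ ∑[ u < n ] (𝟙 (v ∈? U) * 𝟙 (u ∈ₗ? out v))
      pull-out v = *-distribˡ-sum (𝟙 (v ∈? U)) (λ u → 𝟙 (u ∈ₗ? out v))
      outdegree≤D : ∀ v → 𝟙 (v ∈? U) * ∑[ u < n ] 𝟙 (u ∈ₗ? out v) ≤ 𝟙 (v ∈? U) * D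
      outdegree≤D v = *-monoʳ-≤ (𝟙 (v ∈? U)) (≤-trans (∑-𝟙-∈ₗ?≤length (out v)) (|out|≤D v))

    lowIndegree : ∀ {U u₀} → u₀ ∈ U → ∃ λ u → u ∈ U × indegree U u ≤ D
    lowIndegree {U} {u₀} u₀∈U with any? (λ u → (u ∈? U) ×-dec (indegree U u ≤? D))
    ... | yes low = low
    ... | no noLow = contradiction (begin-strict
      size * D         <⟨ +-monoˡ-≤ (size * D) 1≤size ⟩
      size + size * D  ≡⟨ *-suc size D ⟨
      size * suc D     ≤⟨ size*[1+D]≤size*D ⟩
      size * D         ∎) (n≮n (size * D))
      where
      size : ℕ
      size = ∑[ u < n ] 𝟙 (u ∈? U)
      heavy : ∀ u → 𝟙 (u ∈? U) * suc D ≤ indegree U u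
      heavy u with u ∈? U
      ... | no _    = z≤n
      ... | yes u∈U = ≤-trans (≤-reflexive (*-identityˡ (suc D))) (≰⇒> λ low → noLow (u , u∈U , low))
      1≤size : 1 ≤ size
      1≤size = subst (_≤ size) (𝟙-yes (u₀ ∈? U) u₀∈U) (term≤sum (λ u → 𝟙 (u ∈? U)) u₀)
      open ≤-Reasoning
      size*[1+D]≤size*D : size * suc D ≤ size * D
      size*[1+D]≤size*D = begin
        size * suc D                  ≡⟨ *-distribʳ-sum (suc D) (λ u → 𝟙 (u ∈? U)) ⟩
        ∑[ u < n ] (𝟙 (u ∈? U) * suc D) ≤⟨ sum-mono-≤ heavy ⟩
        ∑[ u < n ] indegree U u        ≤⟨ ∑-indegree≤ U ⟩
        size * D                       ∎

    module _ {N : ℕ} (D+D<N : D + D < N) where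

      ProperOn : Subset n → (Fin n → Fin N) → Set
      ProperOn U col = ∀ {a b} → a ∈ U → b ∈ U → b ∈ₗ out a → b ≢ a → col b ≢ col a

      colourLowIndegree : ∀ {U u} → u ∈ U → indegree U u ≤ D →
        Σ (Fin n → Fin N) (ProperOn (U - u)) → Σ (Fin n → Fin N) (ProperOn U)
      colourLowIndegree {U} {u} u∈U indeg≤D (col′ , proper′) = col , proper
        where
        forbidden : List (Fin N)
        forbidden = map col′ (out u) ++ map col′ (inNeighbours U u)

        |forbidden|≤D+D : length forbidden ≤ D + D
        |forbidden|≤D+D = begin
          length forbidden                                          ≡⟨ length-++ (map col′ (out u)) ⟩
          length (map col′ (out u)) + length (map col′ (inNeighbours U u))
            ≡⟨ cong₂ _+_ (length-map col′ (out u)) (length-map col′ (inNeighbours U u)) ⟩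
          length (out u) + indegree U u                             ≤⟨ +-mono-≤ (|out|≤D u) indeg≤D ⟩
          D + D                                                     ∎
          where open ≤-Reasoning

        free : ∃ λ x → x ∉ₗ forbidden
        free = missing-element forbidden (≤-<-trans |forbidden|≤D+D D+D<N)

        col : Fin n → Fin N
        col a with a ≟ u
        ... | yes _ = proj₁ free
        ... | no  _ = col′ a

        proper : ProperOn U col
        proper {a} {b} a∈U b∈U b∈out[a] b≢a with a ≟ u | b ≟ u
        ... | yes refl | yes refl = contradiction refl b≢a
        ... | no a≢u   | no b≢u   =
          proper′ (x∈p∧x≢y⇒x∈p-y a∈U a≢u) (x∈p∧x≢y⇒x∈p-y b∈U b≢u) b∈out[a] b≢a
        ... | yes refl | no _     = λ col′b≡x →
          proj₂ free (subst (_∈ₗ forbidden) col′b≡x (∈-++⁺ˡ (∈-map⁺ col′ b∈out[a])))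
        ... | no _     | yes refl = λ x≡col′a →
          proj₂ free (subst (_∈ₗ forbidden) (sym x≡col′a)
            (∈-++⁺ʳ (map col′ (out u)) (∈-map⁺ col′ (∈-filter⁺ _ (∈-allFin a) (a∈U , b∈out[a])))))

      greedyOn : ∀ s U → ∣ U ∣ ≤ s → Σ (Fin n → Fin N) (ProperOn U)
      greedyOn s U ∣U∣≤s with nonempty? U
      greedyOn s       U ∣U∣≤s   | no empty         =
        (λ _ → fromℕ< (≤-<-trans z≤n D+D<N)) , λ a∈U → contradiction (_ , a∈U) empty
      greedyOn zero    U ∣U∣≤0   | yes (u₀ , u₀∈U) =
        contradiction (≤-trans (x∈p⇒∣p-x∣<∣p∣ u₀∈U) ∣U∣≤0) λ ()
      greedyOn (suc s) U ∣U∣≤1+s | yes (u₀ , u₀∈U) with lowIndegree u₀∈U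
      ... | u , u∈U , indeg≤D = colourLowIndegree u∈U indeg≤D
        (greedyOn s (U - u) (≤-pred (≤-trans (x∈p⇒∣p-x∣<∣p∣ u∈U) ∣U∣≤1+s)))

      greedyColouring : Σ (Fin n → Fin N) λ col → ∀ {a b} → b ∈ₗ out a → b ≢ a → col b ≢ col a
      greedyColouring with greedyOn n ⊤ (≤-reflexive (∣⊤∣≡n n))
      ... | col , proper = col , proper ∈⊤ ∈⊤

subsetsOfSize : (n m : ℕ) → List (Subset n)
subsetsOfSize zero    zero    = [] ∷ []
subsetsOfSize zero    (suc m) = []
subsetsOfSize (suc n) zero    = map (outside ∷_) (subsetsOfSize n zero)
subsetsOfSize (suc n) (suc m) =
  map (inside ∷_) (subsetsOfSize n m) ++ map (outside ∷_) (subsetsOfSize n (suc m))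

length-subsetsOfSize : ∀ n m → length (subsetsOfSize n m) ≡ n C m
length-subsetsOfSize zero    zero    = refl
length-subsetsOfSize zero    (suc m) = sym (k>n⇒nCk≡0 {0} {suc m} (s≤s z≤n))
length-subsetsOfSize (suc n) zero    =
  trans (length-map (outside ∷_) (subsetsOfSize n zero)) (length-subsetsOfSize n zero)
length-subsetsOfSize (suc n) (suc m) = begin
  length (map (inside ∷_) (subsetsOfSize n m) ++ map (outside ∷_) (subsetsOfSize n (suc m)))
    ≡⟨ length-++ (map (inside ∷_) (subsetsOfSize n m)) ⟩
  length (map (inside ∷_) (subsetsOfSize n m)) + length (map (outside ∷_) (subsetsOfSize n (suc m)))
    ≡⟨ cong₂ _+_ (length-map (inside ∷_) (subsetsOfSize n m))
                 (length-map (outside ∷_) (subsetsOfSize n (suc m))) ⟩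
  length (subsetsOfSize n m) + length (subsetsOfSize n (suc m))
    ≡⟨ cong₂ _+_ (length-subsetsOfSize n m) (length-subsetsOfSize n (suc m)) ⟩
  n C m + n C suc m
    ≡⟨ nCk+nC[k+1]≡[n+1]C[k+1] n m ⟩
  suc n C suc m ∎
  where open ≡-Reasoning

∈-subsetsOfSize : ∀ {n} (p : Subset n) → p ∈ₗ subsetsOfSize n ∣ p ∣
∈-subsetsOfSize []            = here refl
∈-subsetsOfSize (inside ∷ p)  = ∈-++⁺ˡ (∈-map⁺ (inside ∷_) (∈-subsetsOfSize p))
∈-subsetsOfSize {suc n} (outside ∷ p) with ∣ p ∣ | ∈-subsetsOfSize p
... | zero  | p∈ = ∈-map⁺ (outside ∷_) p∈
... | suc m | p∈ = ∈-++⁺ʳ (map (inside ∷_) (subsetsOfSize n m)) (∈-map⁺ (outside ∷_) p∈)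

∣insertAt-inside∣ : ∀ {n} (p : Subset n) (x : Fin (suc n)) → ∣ insertAt p x inside ∣ ≡ suc ∣ p ∣
∣insertAt-inside∣ p             zero    = refl
∣insertAt-inside∣ (inside ∷ p)  (suc x) = cong suc (∣insertAt-inside∣ p x)
∣insertAt-inside∣ (outside ∷ p) (suc x) = ∣insertAt-inside∣ p x

subsetsContaining : ∀ {n} → Fin (suc n) → ℕ → List (Subset (suc n))
subsetsContaining {n} x m = map (λ p → insertAt p x inside) (subsetsOfSize n m)

length-subsetsContaining : ∀ {n} (x : Fin (suc n)) m → length (subsetsContaining x m) ≡ n C m
length-subsetsContaining {n} x m =
  trans (length-map (λ p → insertAt p x inside) (subsetsOfSize n m)) (length-subsetsOfSize n m)

∈-subsetsContaining : ∀ {n m} {p : Subset (suc n)} {x} → x ∈ p → ∣ p ∣ ≡ suc m →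
  p ∈ₗ subsetsContaining x m
∈-subsetsContaining {n} {m} {p} {x} x∈p ∣p∣≡1+m =
  subst (_∈ₗ subsetsContaining x m) p′+x≡p (∈-map⁺ (λ q → insertAt q x inside) p′∈)
  where
  p′ : Subset n
  p′ = removeAt p x
  p′+x≡p : insertAt p′ x inside ≡ p
  p′+x≡p = trans (cong (insertAt p′ x) (sym ([]=⇒lookup x∈p))) (insertAt-removeAt p x)
  ∣p′∣≡m : ∣ p′ ∣ ≡ m
  ∣p′∣≡m = suc-injective (begin
    suc ∣ p′ ∣               ≡⟨ ∣insertAt-inside∣ p′ x ⟨
    ∣ insertAt p′ x inside ∣ ≡⟨ cong ∣_∣ p′+x≡p ⟩
    ∣ p ∣                    ≡⟨ ∣p∣≡1+m ⟩
    suc m                    ∎)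
    where open ≡-Reasoning
  p′∈ : p′ ∈ₗ subsetsOfSize n m
  p′∈ = subst (λ s → p′ ∈ₗ subsetsOfSize n s) ∣p′∣≡m (∈-subsetsOfSize p′)

extendToSize : ∀ {n} (q : Subset n) {m} → ∣ q ∣ ≤ m → m ≤ n → ∃ λ p → q ⊆ p × ∣ p ∣ ≡ m
extendToSize []            {zero}  _ _ = [] , id , refl
extendToSize (inside ∷ q)  {zero}  () _
extendToSize (inside ∷ q)  {suc m} (s≤s ∣q∣≤m) (s≤s m≤n) with extendToSize q ∣q∣≤m m≤n
... | p , q⊆p , ∣p∣≡m = inside ∷ p , s⊆s q⊆p , cong suc ∣p∣≡m
extendToSize {suc n} (outside ∷ q) {m} ∣q∣≤m m≤1+n with m ≤? n
... | no m≰n  = ⊤ , ⊆⊤ , trans (∣⊤∣≡n (suc n)) (≤-antisym (≰⇒> m≰n) m≤1+n)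
... | yes m≤n with extendToSize q ∣q∣≤m m≤n
...   | p , q⊆p , ∣p∣≡m = outside ∷ p , s⊆s q⊆p , ∣p∣≡m

x∉p-x : ∀ {n} (p : Subset n) x → x ∉ p - x
x∉p-x (_ ∷ p) (suc x) (there x∈p-x) = x∉p-x p x x∈p-x

∣p∣≤1+∣p-x∣ : ∀ {n} (p : Subset n) x → ∣ p ∣ ≤ suc ∣ p - x ∣
∣p∣≤1+∣p-x∣ (inside  ∷ p) zero    = ≤-reflexive (cong (suc ∘ ∣_∣) (sym (p─⊥≡p p)))
∣p∣≤1+∣p-x∣ (outside ∷ p) zero    = m≤n⇒m≤1+n (≤-reflexive (cong ∣_∣ (sym (p─⊥≡p p))))
∣p∣≤1+∣p-x∣ (inside  ∷ p) (suc x) = s≤s (∣p∣≤1+∣p-x∣ p x)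
∣p∣≤1+∣p-x∣ (outside ∷ p) (suc x) = ∣p∣≤1+∣p-x∣ p x

⊆-image⇒∣q∣≤∣p∣ : ∀ {a b} (p : Subset a) (q : Subset b) (f : Fin a → Fin b) →
  (∀ {j} → j ∈ q → ∃ λ i → i ∈ p × f i ≡ j) → ∣ q ∣ ≤ ∣ p ∣
⊆-image⇒∣q∣≤∣p∣ {b = b} [] q f image = ≤-reflexive (trans (cong ∣_∣ q≡⊥) (∣⊥∣≡0 b))
  where q≡⊥ = Empty-unique λ (_ , j∈q) → ¬Fin0 (proj₁ (image j∈q))
⊆-image⇒∣q∣≤∣p∣ (outside ∷ p) q f image = ⊆-image⇒∣q∣≤∣p∣ p q (f ∘ suc) image′
  where
  image′ : ∀ {j} → j ∈ q → ∃ λ i → i ∈ p × f (suc i) ≡ j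
  image′ j∈q with image j∈q
  ... | suc i , there i∈p , fi≡j = i , i∈p , fi≡j
⊆-image⇒∣q∣≤∣p∣ (inside ∷ p) q f image =
  ≤-trans (∣p∣≤1+∣p-x∣ q (f zero)) (s≤s (⊆-image⇒∣q∣≤∣p∣ p (q - f zero) (f ∘ suc) image′))
  where
  image′ : ∀ {j} → j ∈ q - f zero → ∃ λ i → i ∈ p × f (suc i) ≡ j
  image′ {j} j∈q-f₀ with image (p─q⊆p q _ j∈q-f₀)
  ... | zero  , _         , f₀≡j =
    contradiction (subst (_∈ q - f zero) (sym f₀≡j) j∈q-f₀) (x∉p-x q (f zero))
  ... | suc i , there i∈p , fi≡j = i , i∈p , fi≡j

length-concatMap≤ : ∀ {A B : Set} (f : A → List B) (xs : List A) {d} → (∀ x → length (f x) ≤ d) →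
  length (concatMap f xs) ≤ length xs * d
length-concatMap≤ f []       |f|≤d = z≤n
length-concatMap≤ f (x ∷ xs) |f|≤d =
  ≤-trans (≤-reflexive (length-++ (f x))) (+-mono-≤ (|f|≤d x) (length-concatMap≤ f xs |f|≤d))

-- Rooted forests

greatestBelow : (Q : ℕ → Set) → Decidable Q → Q 0 → ∀ m →
  ∃ λ j → Q j × ∀ {i} → j < i → i ≤ m → ¬ Q i
greatestBelow Q Q? Q0 zero = 0 , Q0 , λ 0<i i≤0 _ → <⇒≱ 0<i i≤0
greatestBelow Q Q? Q0 (suc m) with Q? (suc m)
... | yes Qm = suc m , Qm , λ m<i i≤m _ → <⇒≱ m<i i≤m
... | no ¬Qm with greatestBelow Q Q? Q0 m
...   | j , Qj , none = j , Qj , above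
  where
  above : ∀ {i} → j < i → i ≤ suc m → ¬ Q i
  above {i} j<i i≤1+m with i ℕ.≟ suc m
  ... | yes refl = ¬Qm
  ... | no i≢1+m = none j<i (≤-pred (≤∧≢⇒< i≤1+m i≢1+m))

module Forest {W : Set} (par : W → Maybe W) where

  climb-+ : ∀ i j x {y} → climb par i x ≡ just y → climb par (i + j) x ≡ climb par j y
  climb-+ zero    j x refl = refl
  climb-+ (suc i) j x eq with par x
  ... | just z = climb-+ i j z eq

  climb-+-nothing : ∀ i j x → climb par i x ≡ nothing → climb par (i + j) x ≡ nothing
  climb-+-nothing (suc i) j x eq with par x
  ... | nothing = refl
  ... | just z  = climb-+-nothing i j z eq

  ancestor-trans : ∀ {a b c} → Ancestor par a b → Ancestor par b c → Ancestor par a c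
  ancestor-trans {c = c} (i , a≼b) (j , b≼c) = j + i , trans (climb-+ j i c b≼c) a≼b

  climb-∸ : ∀ {i j x a b} → climb par i x ≡ just a → climb par j x ≡ just b → i ≤ j →
    climb par (j ∸ i) a ≡ just b
  climb-∸ {i} {j} {x} {a} {b} a≼x b≼x i≤j =
    trans (sym (climb-+ i (j ∸ i) x a≼x))
          (subst (λ t → climb par t x ≡ just b) (sym (m+[n∸m]≡n i≤j)) b≼x)

  height : ℕ → W → ℕ
  height zero    x = 0
  height (suc f) x with par x
  ... | nothing = 0
  ... | just y  = suc (height f y)

  height<fuel : ∀ f x → climb par f x ≡ nothing → height f x < f
  height<fuel (suc f) x eq with par x
  ... | nothing = s≤s z≤n
  ... | just y  = s≤s (height<fuel f y eq)

  height-climb : ∀ m f x {y} → climb par m x ≡ just y → height (m + f) x ≡ m + height f y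
  height-climb zero    f x refl = refl
  height-climb (suc m) f x eq with par x
  ... | just z = cong suc (height-climb m f z eq)

  height-+ : ∀ f g x → climb par f x ≡ nothing → height (f + g) x ≡ height f x
  height-+ (suc f) g x eq with par x
  ... | nothing = refl
  ... | just y  = cong suc (height-+ f g y eq)

  ancestorsUpTo : ℕ → W → List W
  ancestorsUpTo zero    x = []
  ancestorsUpTo (suc m) x with par x
  ... | nothing = []
  ... | just y  = y ∷ ancestorsUpTo m y

  length-ancestorsUpTo : ∀ m x → length (ancestorsUpTo m x) ≤ m
  length-ancestorsUpTo zero    x = z≤n
  length-ancestorsUpTo (suc m) x with par x
  ... | nothing = z≤n
  ... | just y  = s≤s (length-ancestorsUpTo m y)

  ∈-ancestorsUpTo : ∀ {m j x y} → climb par (suc j) x ≡ just y → j < m → y ∈ₗ ancestorsUpTo m x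
  ∈-ancestorsUpTo {suc m} {j} {x} y≼x (s≤s j≤m) with par x
  ∈-ancestorsUpTo {suc m} {zero}  y≼x (s≤s j≤m) | just z = here (sym (just-injective y≼x))
  ∈-ancestorsUpTo {suc m} {suc j} y≼x (s≤s j≤m) | just z = there (∈-ancestorsUpTo y≼x j≤m)

  module _ {d} (depth≤d : DepthAtMost par d) where

    climb-≥ : ∀ {m} x → d ≤ m → climb par m x ≡ nothing
    climb-≥ {m} x d≤m = subst (λ t → climb par t x ≡ nothing)
      (trans (+-comm d (m ∸ d)) (m∸n+n≡m d≤m)) (climb-+-nothing d (m ∸ d) x (depth≤d x))

    climb≡just⇒< : ∀ {m x y} → climb par m x ≡ just y → m < d
    climb≡just⇒< {m} {x} y≼x with m <? d
    ... | yes m<d = m<d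
    ... | no  m≮d = contradiction (trans (sym y≼x) (climb-≥ x (≮⇒≥ m≮d))) λ ()

    -- r is the highest ancestor of x inside P. A walk inside P cannot get past r: an edge
    -- from a descendant of r up to a proper ancestor b of r would make b a higher such ancestor.
    topmostAncestor : (E : W → W → Set) → (∀ {a b} → E a b → Ancestor par a b ⊎ Ancestor par b a) →
      (P : W → Set) → Decidable P → ∀ {x} → P x →
      ∃ λ r → P r × ∀ {w} → Star (λ a b → E a b × P b) x w → Ancestor par r w
    topmostAncestor E comparable P P? {x} Px with greatestBelow InP InP? (x , refl , Px) d
      where
      InP : ℕ → Set
      InP j = ∃ λ y → climb par j x ≡ just y × P y
      InP? : Decidable InP
      InP? j with climb par j x
      ... | nothing = no λ ()
      ... | just y with P? y
      ...   | yes Py = yes (y , refl , Py)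
      ...   | no ¬Py = no λ { (_ , refl , Py) → ¬Py Py }
    ... | j , (r , r≼x , Pr) , noneHigher = r , Pr , reach (j , r≼x)
      where
      higherNotInP : ∀ {i y} → j < i → climb par i x ≡ just y → ¬ P y
      higherNotInP j<i y≼x Py = noneHigher j<i (<⇒≤ (climb≡just⇒< y≼x)) (_ , y≼x , Py)

      staysBelow : ∀ {a b} → Ancestor par r a → E a b → P b → Ancestor par r b
      staysBelow r≼a eab Pb with comparable eab
      ... | inj₁ a≼b = ancestor-trans r≼a a≼b
      staysBelow (i₀ , r≼a) eab Pb | inj₂ (i , b≼a) with i ≤? i₀
      ... | yes i≤i₀ = i₀ ∸ i , climb-∸ b≼a r≼a i≤i₀
      ... | no  i≰i₀ = contradiction Pb (higherNotInP (m<m+n j (m<n⇒0<n∸m (≰⇒> i≰i₀)))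
                         (trans (climb-+ j (i ∸ i₀) x r≼x) (climb-∸ r≼a b≼a (≰⇒≥ i≰i₀))))

      reach : ∀ {a w} → Ancestor par r a → Star (λ a b → E a b × P b) a w → Ancestor par r w
      reach r≼a ε                 = r≼a
      reach r≼a ((eab , Pb) ◅ ab*) = reach (staysBelow r≼a eab Pb) ab*

    height-properAncestor : ∀ {j w r} → climb par (suc j) w ≡ just r → height d w ≢ height d r
    height-properAncestor {j} {w} {r} r≺w hw≡hr = m≢1+n+m (height d r) (begin
      height d r                   ≡⟨ hw≡hr ⟨
      height d w                   ≡⟨ cong (λ f → height f w) d≡1+j+t ⟩
      height (suc j + t) w         ≡⟨ height-climb (suc j) t w r≺w ⟩
      suc j + height t r           ≡⟨ cong (suc j +_) (height-+ t (suc j) r climb-t-r) ⟨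
      suc j + height (t + suc j) r ≡⟨ cong (λ f → suc j + height f r) t+1+j≡d ⟩
      suc (j + height d r)         ∎)
      where
      open ≡-Reasoning
      t : ℕ
      t = d ∸ suc j
      d≡1+j+t : d ≡ suc j + t
      d≡1+j+t = sym (m+[n∸m]≡n (<⇒≤ (climb≡just⇒< r≺w)))
      t+1+j≡d : t + suc j ≡ d
      t+1+j≡d = trans (+-comm t (suc j)) (sym d≡1+j+t)
      climb-t-r : climb par t r ≡ nothing
      climb-t-r = trans (sym (climb-+ (suc j) t w r≺w))
                        (subst (λ f → climb par f w ≡ nothing) d≡1+j+t (depth≤d w))

module _ (G : Graph) {k : ℕ} (c : Coloring G k) where

  ∈-colorsOn⁺ : ∀ {X v} → v ∈ X → c v ∈ colorsOn G c X
  ∈-colorsOn⁺ {X} {v} v∈X = lookup⇒[]= (c v) (colorsOn G c X) (trans (lookup∘tabulate _ (c v)) found)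
    where
    found : ⌊ any? (λ u → (u ∈? X) ×-dec (c u ≟ c v)) ⌋ ≡ true
    found with any? (λ u → (u ∈? X) ×-dec (c u ≟ c v))
    ... | yes _   = refl
    ... | no none = contradiction (v , v∈X , refl) none

  ∈-colorsOn⁻ : ∀ {X j} → j ∈ colorsOn G c X → ∃ λ v → v ∈ X × c v ≡ j
  ∈-colorsOn⁻ {X} {j} j∈
    with any? (λ u → (u ∈? X) ×-dec (c u ≟ j)) | trans (sym (lookup∘tabulate _ j)) ([]=⇒lookup j∈)
  ... | yes witness | _ = witness
  ... | no _        | ()

∈-irrelevant : ∀ {n} {p : Subset n} {x} (a b : x ∈ p) → a ≡ b
∈-irrelevant = []=-irrelevant

module Decomposition (G : Graph) {k : ℕ} (c : Coloring G k) (S : Subset k) {d : ℕ}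
  (par : InClasses G c S → Maybe (InClasses G c S)) (depth≤d : DepthAtMost par d)
  (comparable : ∀ u v → Adj G (proj₁ u) (proj₁ v) → Ancestor par u v ⊎ Ancestor par v u) where

  open Forest par

  module _ {X : Subset (n G)} (X⊆S : ∀ {v} → v ∈ X → c v ∈ S) where

    InX : InClasses G c S → Set
    InX a = proj₁ a ∈ X

    ⟨_⟩ : ∀ {v} → v ∈ X → InClasses G c S
    ⟨_⟩ {v} v∈X = v , X⊆S v∈X

    walk : ∀ {u v} (u∈X : u ∈ X) (v∈X : v ∈ X) → ReachIn G X u v →
      Star (λ a b → Adj G (proj₁ a) (proj₁ b) × InX b) ⟨ u∈X ⟩ ⟨ v∈X ⟩
    walk u∈X v∈X (here _) rewrite ∈-irrelevant u∈X v∈X = ε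
    walk u∈X v∈X (step _ uw rest) = (uw , start rest) ◅ walk (start rest) v∈X rest
      where
      start : ∀ {w v} → ReachIn G X w v → w ∈ X
      start (here w∈X)     = w∈X
      start (step w∈X _ _) = w∈X

    commonAncestor : Connected G X →
      ∃ λ r → InX r × ∀ {w} (w∈X : w ∈ X) → Ancestor par r ⟨ w∈X ⟩
    commonAncestor ((x , x∈X) , connected)
      with topmostAncestor {d = d} depth≤d _ (comparable _ _) InX (λ a → proj₁ a ∈? X) x∈X
    ... | r , r∈X , below = r , r∈X , λ w∈X → below (walk x∈X w∈X (connected _ _ x∈X w∈X))

    separatesAncestors⇒uniqueColour : ∀ {m} (κ : Coloring G m) →
      (∀ {j w r} → climb par (suc j) w ≡ just r → proj₁ w ≢ proj₁ r →
                   κ (proj₁ w) ≢ κ (proj₁ r)) →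
      Connected G X → HasUniqueColor G κ X
    separatesAncestors⇒uniqueColour κ separates connected with commonAncestor connected
    ... | r , r∈X , r≼ = proj₁ r , r∈X , unique
      where
      unique : ∀ w → w ∈ X → κ w ≡ κ (proj₁ r) → w ≡ proj₁ r
      unique w w∈X κw≡κr with w ≟ proj₁ r | r≼ w∈X
      ... | yes w≡r | _                     = w≡r
      ... | no  w≢r | zero  , just[w]≡just[r] =
        contradiction (cong proj₁ (just-injective just[w]≡just[r])) w≢r
      ... | no  w≢r | suc j , r≺w           = contradiction κw≡κr (separates r≺w w≢r)

∣colorsOn∣-mono : (G : Graph) {a b : ℕ} (κ : Coloring G a) (c : Coloring G b) (f : Fin a → Fin b) →
  (∀ v → f (κ v) ≡ c v) → ∀ X → ∣ colorsOn G c X ∣ ≤ ∣ colorsOn G κ X ∣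
∣colorsOn∣-mono G κ c f f∘κ≡c X = ⊆-image⇒∣q∣≤∣p∣ (colorsOn G κ X) (colorsOn G c X) f preimage
  where
  preimage : ∀ {j} → j ∈ colorsOn G c X → ∃ λ i → i ∈ colorsOn G κ X × f i ≡ j
  preimage j∈ with ∈-colorsOn⁻ G c j∈
  ... | v , v∈X , refl = κ v , ∈-colorsOn⁺ G κ v∈X , f∘κ≡c v

-- The two colourings

module HeightColouring (p k : ℕ) (G : Graph) (c : Coloring G k) (td : IsTreedepthColoring p G c)
  (k<p : k < p) where

  decomposition : TreedepthAtMost (InClasses G c ⊤) (λ a b → Adj G (proj₁ a) (proj₁ b)) k
  decomposition = td k (<⇒≤ k<p) ⊤ (∣⊤∣≡n k)

  par : InClasses G c ⊤ → Maybe (InClasses G c ⊤)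
  par = proj₁ decomposition

  depth≤k : DepthAtMost par k
  depth≤k = proj₁ (proj₂ decomposition)

  open Forest par
  open Decomposition G c ⊤ {k} par depth≤k (proj₂ (proj₂ decomposition))

  heightColour : Fin (n G) → Fin k
  heightColour v = fromℕ< (height<fuel k (v , ∈⊤) (depth≤k _))

  centred : ∀ {m} (z : Fin m) → IsCenteredColoring (suc p) G (λ v → combine (heightColour v) z)
  centred z X connected = inj₁ (separatesAncestors⇒uniqueColour (λ _ → ∈⊤) _ separates connected)
    where
    toℕ-heightColour : ∀ w → toℕ (heightColour (proj₁ w)) ≡ height k w
    toℕ-heightColour (w , w∈⊤) =
      trans (toℕ-fromℕ< _) (cong (λ q → height k (w , q)) (∈-irrelevant ∈⊤ w∈⊤))
    separates : ∀ {j w r} → climb par (suc j) w ≡ just r → proj₁ w ≢ proj₁ r →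
      combine (heightColour (proj₁ w)) z ≢ combine (heightColour (proj₁ r)) z
    separates {w = w} {r} r≺w _ same = height-properAncestor {d = k} depth≤k r≺w (begin
      height k w                   ≡⟨ toℕ-heightColour w ⟨
      toℕ (heightColour (proj₁ w)) ≡⟨ cong toℕ (combine-injectiveˡ _ z _ z same) ⟩
      toℕ (heightColour (proj₁ r)) ≡⟨ toℕ-heightColour r ⟩
      height k r                   ∎)
      where open ≡-Reasoning

  centredColouring : ∀ {m} → Fin m → Σ (Coloring G (k * m)) (IsCenteredColoring (suc p) G)
  centredColouring z = _ , centred z

module AncestorColouring (p′ k′ : ℕ) (G : Graph) (c : Coloring G (suc k′))
  (td : IsTreedepthColoring (suc p′) G c) (p≤k : suc p′ ≤ suc k′) where

  p k m : ℕ
  p = suc p′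
  k = suc k′
  m = 2 * p * (k′ C p′) + 1

  -- Junk value: the empty forest when ∣ S ∣ ≢ p, so that ancestors can be listed for every S.
  forestOn : (S : Subset k) → InClasses G c S → Maybe (InClasses G c S)
  forestOn S with ∣ S ∣ ℕ.≟ p
  ... | yes ∣S∣≡p = proj₁ (td p (≤-reflexive refl) S ∣S∣≡p)
  ... | no  _     = λ _ → nothing

  forestOn-decomposes : ∀ S → ∣ S ∣ ≡ p → DepthAtMost (forestOn S) p ×
    (∀ u v → Adj G (proj₁ u) (proj₁ v) → Ancestor (forestOn S) u v ⊎ Ancestor (forestOn S) v u)
  forestOn-decomposes S ∣S∣≡p with ∣ S ∣ ℕ.≟ p
  ... | yes ∣S∣≡p′ = proj₂ (td p (≤-reflexive refl) S ∣S∣≡p′)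
  ... | no  ∣S∣≢p  = contradiction ∣S∣≡p ∣S∣≢p

  ancestorsIn : Subset k → Fin (n G) → List (Fin (n G))
  ancestorsIn S w with c w ∈? S
  ... | yes c[w]∈S = map proj₁ (Forest.ancestorsUpTo (forestOn S) p (w , c[w]∈S))
  ... | no  _      = []

  conflicts : Fin (n G) → List (Fin (n G))
  conflicts w = concatMap (λ S → ancestorsIn S w) (subsetsContaining (c w) p′)

  length-ancestorsIn : ∀ w S → length (ancestorsIn S w) ≤ p
  length-ancestorsIn w S with c w ∈? S
  ... | yes c[w]∈S = ≤-trans (≤-reflexive (length-map proj₁ (ancestorsUpTo p (w , c[w]∈S))))
                             (length-ancestorsUpTo p (w , c[w]∈S))
    where open Forest (forestOn S)
  ... | no  _      = z≤n

  length-conflicts : ∀ w → length (conflicts w) ≤ (k′ C p′) * p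
  length-conflicts w = begin
    length (conflicts w)                    ≤⟨ length-concatMap≤ (λ S → ancestorsIn S w) Ss (length-ancestorsIn w) ⟩
    length Ss * p                           ≡⟨ cong (_* p) (length-subsetsContaining (c w) p′) ⟩
    (k′ C p′) * p                           ∎
    where
    open ≤-Reasoning
    Ss : List (Subset k)
    Ss = subsetsContaining (c w) p′

  ∈-conflicts : ∀ {S j w r} → ∣ S ∣ ≡ p → climb (forestOn S) (suc j) w ≡ just r →
    proj₁ r ∈ₗ conflicts (proj₁ w)
  ∈-conflicts {S} {j} {w , c[w]∈S} {r} ∣S∣≡p r≺w =
    ∈-concat⁺′ r∈ancestors (∈-map⁺ (λ S → ancestorsIn S w) (∈-subsetsContaining c[w]∈S ∣S∣≡p))
    where
    r∈ancestors : proj₁ r ∈ₗ ancestorsIn S w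
    r∈ancestors with c w ∈? S
    ... | no  c[w]∉S  = contradiction c[w]∈S c[w]∉S
    ... | yes c[w]∈S′ rewrite ∈-irrelevant c[w]∈S′ c[w]∈S =
      ∈-map⁺ proj₁ (∈-ancestorsUpTo r≺w (<⇒≤ (climb≡just⇒< {d = p} (proj₁ (forestOn-decomposes S ∣S∣≡p)) r≺w)))
      where open Forest (forestOn S)

  D+D<m : (k′ C p′) * p + (k′ C p′) * p < m
  D+D<m = subst (_< m) (twice (k′ C p′) p) (m<m+n _ (s≤s z≤n))
    where
    twice : ∀ a b → 2 * b * a ≡ a * b + a * b
    twice = solve-∀

  module _ (rank : Fin (n G) → Fin m)
    (rank-separates : ∀ {a b} → b ∈ₗ conflicts a → b ≢ a → rank b ≢ rank a) where

    colouring : Coloring G (k * m)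
    colouring v = combine (c v) (rank v)

    centred : IsCenteredColoring (suc p) G colouring
    centred X connected with suc p ≤? ∣ colorsOn G colouring X ∣
    ... | yes many = inj₂ many
    ... | no  few
      with extendToSize (colorsOn G c X) (≤-trans ∣c[X]∣≤∣colouring[X]∣ (≤-pred (≰⇒> few))) p≤k
      where
      ∣c[X]∣≤∣colouring[X]∣ : ∣ colorsOn G c X ∣ ≤ ∣ colorsOn G colouring X ∣
      ∣c[X]∣≤∣colouring[X]∣ = ∣colorsOn∣-mono G colouring c (proj₁ ∘ remQuot m)
        (λ v → cong proj₁ (remQuot-combine (c v) (rank v))) X
    ...   | S , c[X]⊆S , ∣S∣≡p =
      inj₁ (separatesAncestors⇒uniqueColour (c[X]⊆S ∘ ∈-colorsOn⁺ G c) colouring separates connected)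
      where
      open Decomposition G c S {p} (forestOn S) (proj₁ (forestOn-decomposes S ∣S∣≡p))
                                                (proj₂ (forestOn-decomposes S ∣S∣≡p))
      separates : ∀ {j w r} → climb (forestOn S) (suc j) w ≡ just r → proj₁ w ≢ proj₁ r →
        colouring (proj₁ w) ≢ colouring (proj₁ r)
      separates {w = w} {r} r≺w w≢r same =
        rank-separates (∈-conflicts ∣S∣≡p r≺w) (w≢r ∘ sym)
          (sym (combine-injectiveʳ (c (proj₁ w)) _ (c (proj₁ r)) _ same))

  centredColouring : Σ (Coloring G (k * m)) (IsCenteredColoring (suc p) G)
  centredColouring with GreedyColouring.greedyColouring conflicts length-conflicts D+D<m
  ... | rank , rank-separates = colouring rank rank-separates , centred rank rank-separates

-- The number of colours

nCk≤n^k : ∀ n k → n C k ≤ n ^ k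
nCk≤n^k n       zero    = ≤-refl
nCk≤n^k zero    (suc k) = ≤-reflexive (k>n⇒nCk≡0 {0} {suc k} (s≤s z≤n))
nCk≤n^k (suc n) (suc k) = begin
  suc n C suc k            ≡⟨ nCk+nC[k+1]≡[n+1]C[k+1] n k ⟨
  n C k + n C suc k        ≤⟨ +-mono-≤ (nCk≤n^k n k) (nCk≤n^k n (suc k)) ⟩
  n ^ k + n * n ^ k        ≤⟨ +-mono-≤ n^k≤[1+n]^k (*-monoʳ-≤ n n^k≤[1+n]^k) ⟩
  suc n ^ k + n * suc n ^ k ∎
  where
  open ≤-Reasoning
  n^k≤[1+n]^k : n ^ k ≤ suc n ^ k
  n^k≤[1+n]^k = ^-monoˡ-≤ k (n≤1+n n)

colourBound : ∀ p′ k′ → 1 ≤ p′ →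
  suc k′ * (2 * suc p′ * (k′ C p′) + 1) < 2 * suc p′ * suc k′ ^ suc p′
colourBound p′ k′ 1≤p′ = begin-strict
  K * (Z * a + 1)        ≡⟨ distribute K Z a ⟩
  K * (Z * a) + K        <⟨ +-monoʳ-< (K * (Z * a)) (m<m*n K Z (*-monoʳ-≤ 2 (s≤s z≤n))) ⟩
  K * (Z * a) + K * Z    ≡⟨ regroup K Z a ⟩
  Z * (K * (a + 1))      ≤⟨ *-monoʳ-≤ Z (*-monoʳ-≤ K a+1≤K^p′) ⟩
  Z * (K * K ^ p′)       ∎
  where
  open ≤-Reasoning
  K Z a : ℕ
  K = suc k′
  Z = 2 * suc p′
  a = k′ C p′
  a+1≤K^p′ : a + 1 ≤ K ^ p′
  a+1≤K^p′ = subst (_≤ K ^ p′) (+-comm 1 a)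
    (≤-<-trans (nCk≤n^k k′ p′) (^-monoˡ-< p′ {{ℕ.>-nonZero 1≤p′}} (n<1+n k′)))
  distribute : ∀ K Z a → K * (Z * a + 1) ≡ K * (Z * a) + K
  distribute = solve-∀
  regroup : ∀ K Z a → K * (Z * a) + K * Z ≡ Z * (K * (a + 1))
  regroup = solve-∀

mainTheorem12 : (p k : ℕ) → 2 ≤ p → 1 ≤ k → (G : Graph) →
    (c : Coloring G k) → IsTreedepthColoring p G c →
      (Σ (Coloring G (k * (2 * p * ((k ∸ 1) C (p ∸ 1)) + 1))) λ c′ →
         IsCenteredColoring (suc p) G c′)
      × (k * (2 * p * ((k ∸ 1) C (p ∸ 1)) + 1) < 2 * p * k ^ p)
mainTheorem12 (suc p′) (suc k′) (s≤s 1≤p′) _ G c td = centredColouring , colourBound p′ k′ 1≤p′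
  where
  centredColouring :
    Σ (Coloring G (suc k′ * (2 * suc p′ * (k′ C p′) + 1))) (IsCenteredColoring (suc (suc p′)) G)
  centredColouring with suc p′ ≤? suc k′
  ... | yes p≤k = AncestorColouring.centredColouring p′ k′ G c td p≤k
  ... | no  p≰k =
    HeightColouring.centredColouring (suc p′) (suc k′) G c td (≰⇒> p≰k) (fromℕ< (m≤n+m 1 _))
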